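{- Let $A_1,\dots,A_n$ be coherent quantales and $A=\prod_{i=1}^n A_i$. Then: (1) $A$ has LP if and only if $A_i$ has LP for every $i\in\{1,\dots,n\}$; (2) $A$ has the property (*) if and only if $A_i$ has the property (*) for every $i\in\{1,\dots,n\}$.
   Context: A quantale is a complete lattice $(A,\vee,\wedge,0,1)$ with an associative, commutative multiplication $\cdot$ with unit $1$ distributing over arbitrary joins; products carry componentwise operations. $K(Q)$ is the set of compact elements of $Q$; $Q$ is coherent if every element is a join of compact elements, $1\in K(Q)$ and $K(Q)$ is closed under $\cdot$. $B(Q)$ is the Boolean algebra of complemented elements. $Max(Q)$ is the set of maximal elements of $Q\setminus\{1\}$ and $r(Q)=\bigwedge Max(Q)$. For $a\in Q$, $[a)_Q=\{x\in Q:a\le x\}$ is a quantale with the lattice operations of $Q$, bottom $a$, top $1$, multiplication $x\cdot_a y=(x\cdot y)\vee a$. An element $a$ has LP if the Boolean morphism $B(Q)\to B([a)_Q)$, $e\mapsto e\vee a$, is surjective; $Q$ has LP if every element has LP. $Q$ has property (*) if for every $a\in Q$ there exist $c\in K(Q)$ with $c\le r(Q)$ and $e\in B(Q)$ with $a=c\vee e$. -}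

module Defs where

open import Data.Nat using (ℕ)
open import Data.Fin using (Fin)
open import Data.Bool using (Bool; true; false)
open import Data.Empty using (⊥)
open import Data.Product using (Σ; ∃; _×_; _,_; proj₁; proj₂)
open import Function using (_∘_; id)
open import Relation.Nullary using (¬_)

-- The order is given as a preorder _≤_, and equality of
-- elements is taken to be the induced equivalence _≈_ (x ≤ y and y ≤ x), so
-- that products can be built without function extensionality.
record Quantale : Set₁ where
  infix 4 _≤_ _≈_
  infixl 7 _·_
  field
    Carrier : Set
    _≤_     : Carrier → Carrier → Set
    ≤-refl  : ∀ {x} → x ≤ x
    ≤-trans : ∀ {x y z} → x ≤ y → y ≤ z → x ≤ z
    ⋁       : {I : Set} → (I → Carrier) → Carrier
    ⋁-upper : ∀ {I : Set} (f : I → Carrier) (i : I) → f i ≤ ⋁ f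
    ⋁-least : ∀ {I : Set} (f : I → Carrier) (x : Carrier) →
              (∀ i → f i ≤ x) → ⋁ f ≤ x
    _·_     : Carrier → Carrier → Carrier
    1q      : Carrier

  _≈_ : Carrier → Carrier → Set
  x ≈ y = (x ≤ y) × (y ≤ x)

  field
    ·-mono  : ∀ {x y u v} → x ≤ y → u ≤ v → x · u ≤ y · v
    ·-assoc : ∀ x y z → (x · y) · z ≈ x · (y · z)
    ·-comm  : ∀ x y → x · y ≈ y · x
    ·-unit  : ∀ x → x · 1q ≈ x
    1-top   : ∀ x → x ≤ 1q
    ·-distrib-⋁ : ∀ (x : Carrier) {I : Set} (f : I → Carrier) →
                  x · ⋁ f ≈ ⋁ (λ i → x · f i)

  0q : Carrier
  0q = ⋁ {⊥} (λ ())

  _∨_ : Carrier → Carrier → Carrier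
  x ∨ y = ⋁ {Bool} (λ { true → x ; false → y })

  ⋀ₚ : (Carrier → Set) → Carrier
  ⋀ₚ P = ⋁ {Σ Carrier (λ y → ∀ m → P m → y ≤ m)} proj₁

  _∧_ : Carrier → Carrier → Carrier
  x ∧ y = ⋁ {Σ Carrier (λ z → (z ≤ x) × (z ≤ y))} proj₁

  IsCompact : Carrier → Set₁
  IsCompact c = ∀ {I : Set} (f : I → Carrier) → c ≤ ⋁ f →
    Σ ℕ (λ k → Σ (Fin k → I) (λ g → c ≤ ⋁ (f ∘ g)))

  IsComplemented : Carrier → Set
  IsComplemented e = Σ Carrier (λ b → ((e ∨ b) ≈ 1q) × ((e ∧ b) ≈ 0q))

  IsMax : Carrier → Set
  IsMax m = (¬ (m ≈ 1q)) × (∀ x → m ≤ x → ¬ (x ≈ 1q) → x ≈ m)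

  r : Carrier
  r = ⋀ₚ IsMax

  -- complemented elements of the quantale [a)_Q (bottom a, top 1, with the
  -- lattice operations of Q; meets of elements ≥ a are the meets in Q)
  IsComplementedAbove : Carrier → Carrier → Set
  IsComplementedAbove a x =
    Σ Carrier (λ y → (a ≤ y) × ((x ∨ y) ≈ 1q) × ((x ∧ y) ≈ a))

  HasLPAt : Carrier → Set
  HasLPAt a = ∀ x → a ≤ x → IsComplementedAbove a x →
    Σ Carrier (λ e → IsComplemented e × ((e ∨ a) ≈ x))

module Q = Quantale

IsCoherent : Quantale → Set₁
IsCoherent Q =
  (∀ a → Σ Set (λ I → Σ (I → Carrier) (λ f →
           (∀ i → IsCompact (f i)) × (a ≈ ⋁ f))))
  × IsCompact 1q
  × (∀ c d → IsCompact c → IsCompact d → IsCompact (c · d))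
  where open Quantale Q

HasLP : Quantale → Set
HasLP Q = ∀ a → Q.HasLPAt Q a

HasStar : Quantale → Set₁
HasStar Q = ∀ a → Σ Carrier (λ c → IsCompact c × (c ≤ r) ×
                    Σ Carrier (λ e → IsComplemented e × (a ≈ (c ∨ e))))
  where open Quantale Q

∏ : (n : ℕ) → (Fin n → Quantale) → Quantale
∏ n A = record
  { Carrier = (i : Fin n) → Q.Carrier (A i)
  ; _≤_ = λ x y → ∀ i → Q._≤_ (A i) (x i) (y i)
  ; ≤-refl = λ i → Q.≤-refl (A i)
  ; ≤-trans = λ p q i → Q.≤-trans (A i) (p i) (q i)
  ; ⋁ = λ f i → Q.⋁ (A i) (λ j → f j i)
  ; ⋁-upper = λ f j i → Q.⋁-upper (A i) (λ j → f j i) j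
  ; ⋁-least = λ f x h i → Q.⋁-least (A i) (λ j → f j i) (x i) (λ j → h j i)
  ; _·_ = λ x y i → Q._·_ (A i) (x i) (y i)
  ; 1q = λ i → Q.1q (A i)
  ; ·-mono = λ p q i → Q.·-mono (A i) (p i) (q i)
  ; ·-assoc = λ x y z → (λ i → proj₁ (Q.·-assoc (A i) (x i) (y i) (z i)))
                       , (λ i → proj₂ (Q.·-assoc (A i) (x i) (y i) (z i)))
  ; ·-comm = λ x y → (λ i → proj₁ (Q.·-comm (A i) (x i) (y i)))
                    , (λ i → proj₂ (Q.·-comm (A i) (x i) (y i)))
  ; ·-unit = λ x → (λ i → proj₁ (Q.·-unit (A i) (x i)))
                  , (λ i → proj₂ (Q.·-unit (A i) (x i)))
  ; 1-top = λ x i → Q.1-top (A i) (x i)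
  ; ·-distrib-⋁ = λ x f →
      (λ i → proj₁ (Q.·-distrib-⋁ (A i) (x i) (λ j → f j i)))
    , (λ i → proj₂ (Q.·-distrib-⋁ (A i) (x i) (λ j → f j i)))
  }

module Submission where

open import Defs
open import Data.Nat using (ℕ)
open import Data.Fin using (Fin; _≟_)
open import Data.Bool using (true; false)
open import Data.Empty using (⊥-elim)
open import Data.Product using (Σ; _×_; _,_; proj₁; proj₂)
open import Data.List using (List; tabulate; concatMap; lookup; allFin)
open import Data.List.Membership.Propositional using (_∈_)
open import Data.List.Membership.Propositional.Properties using (∈-tabulate⁺; ∈-concatMap⁺)
open import Data.List.Relation.Unary.Any using (index)
open import Data.List.Relation.Unary.Any.Properties using (lookup-index; tabulate⁺)
open import Function using (_∘_)
open import Function.Bundles using (_⇔_; mk⇔)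
open import Relation.Nullary using (¬_; yes; no)
open import Relation.Binary.PropositionalEquality using (_≡_; _≢_; refl; sym; subst)

-- Joins, meets, complements, complements in [a) and compactness in ∏ Aᵢ are
-- all computed coordinatewise, and the maximal elements of ∏ Aᵢ are the
-- points that are 1 in all coordinates but one and maximal there, so that
-- r(∏ Aᵢ) = (r(Aᵢ))ᵢ.  Hence LP and (*) hold at a point of the product as soon
-- as they hold at its coordinates.  Conversely, a ∈ Aᵢ is the i-th coordinate
-- of the point padded with 1 elsewhere (for LP) or with 0 elsewhere (for (*),
-- which forces the compact part of a decomposition to vanish off i).

module QuantaleProperties (Q : Quantale) where
  open Quantale Q public

  ≈-sym : ∀ {x y} → x ≈ y → y ≈ x
  ≈-sym (x≤y , y≤x) = y≤x , x≤y

  ≈-trans : ∀ {x y z} → x ≈ y → y ≈ z → x ≈ z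
  ≈-trans (x≤y , y≤x) (y≤z , z≤y) = ≤-trans x≤y y≤z , ≤-trans z≤y y≤x

  ≤-reflexive : ∀ {x y} → x ≡ y → x ≤ y
  ≤-reflexive refl = ≤-refl

  0-least : ∀ x → 0q ≤ x
  0-least x = ⋁-least _ x (λ ())

  x≤x∨y : ∀ {x y} → x ≤ x ∨ y
  x≤x∨y = ⋁-upper _ true

  y≤x∨y : ∀ {x y} → y ≤ x ∨ y
  y≤x∨y = ⋁-upper _ false

  ∨-least : ∀ {x y z} → x ≤ z → y ≤ z → x ∨ y ≤ z
  ∨-least {z = z} x≤z y≤z = ⋁-least _ z (λ { true → x≤z ; false → y≤z })

  x∧y≤y : ∀ {x y} → x ∧ y ≤ y
  x∧y≤y {y = y} = ⋁-least _ y (proj₂ ∘ proj₂)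

  ∧-greatest : ∀ {x y z} → z ≤ x → z ≤ y → z ≤ x ∧ y
  ∧-greatest {z = z} z≤x z≤y = ⋁-upper _ (z , z≤x , z≤y)

  ⋁-mono : ∀ {I : Set} {f g : I → Carrier} → (∀ i → f i ≤ g i) → ⋁ f ≤ ⋁ g
  ⋁-mono {g = g} f≤g = ⋁-least _ _ (λ i → ≤-trans (f≤g i) (⋁-upper g i))

  ⋁-lookup-upper : ∀ {I : Set} (f : I → Carrier) {xs : List I} {i} →
                   i ∈ xs → f i ≤ ⋁ (f ∘ lookup xs)
  ⋁-lookup-upper f i∈xs =
    subst (λ t → f t ≤ _) (sym (lookup-index i∈xs)) (⋁-upper _ (index i∈xs))

  r≤max : ∀ {m} → IsMax m → r ≤ m
  r≤max {m} m-max = ⋁-least _ m (λ lb → proj₂ lb m m-max)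

  ≤-r : ∀ {x} → (∀ m → IsMax m → x ≤ m) → x ≤ r
  ≤-r {x} x≤max = ⋁-upper _ (x , x≤max)

  1-isComplementedAbove : ∀ a → IsComplementedAbove a 1q
  1-isComplementedAbove a =
    a , ≤-refl , (1-top _ , x≤x∨y) , (x∧y≤y , ∧-greatest (1-top a) ≤-refl)

  HasStarAt : Carrier → Set₁
  HasStarAt a = Σ Carrier (λ c → IsCompact c × (c ≤ r) ×
                  Σ Carrier (λ e → IsComplemented e × (a ≈ (c ∨ e))))

module Product {n : ℕ} (A : Fin n → Quantale) where
  open QuantaleProperties (∏ n A)
  module Aᵢ (i : Fin n) = QuantaleProperties (A i)

  C : Fin n → Set
  C i = Aᵢ.Carrier i

  onComponents : ∀ i {R : Fin n → Set} → R i → (∀ {j} → i ≢ j → R j) → ∀ j → R j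
  onComponents i Rᵢ Rⱼ j with i ≟ j
  ... | yes refl = Rᵢ
  ... | no i≢j = Rⱼ i≢j

  update : (i : Fin n) → C i → Carrier → Carrier
  update i v d j with i ≟ j
  ... | yes refl = v
  ... | no _ = d j

  update-same : ∀ i v d → update i v d i ≡ v
  update-same i v d with i ≟ i
  ... | yes refl = refl
  ... | no i≢i = ⊥-elim (i≢i refl)

  update-other : ∀ {i j} v d → i ≢ j → update i v d j ≡ d j
  update-other {i} {j} v d i≢j with i ≟ j
  ... | yes refl = ⊥-elim (i≢j refl)
  ... | no _ = refl

  update-pointwise : ∀ {i v d} (R : ∀ j → C j → Set) → R i v →
                     (∀ {j} → i ≢ j → R j (d j)) → ∀ j → R j (update i v d j)
  update-pointwise {i} R Rv Rd j with i ≟ j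
  ... | yes refl = Rv
  ... | no i≢j = Rd i≢j

  ≈-component : ∀ {x y} → x ≈ y → ∀ i → Aᵢ._≈_ i (x i) (y i)
  ≈-component (x≤y , y≤x) i = x≤y i , y≤x i

  ≈-tuple : ∀ {x y} → (∀ i → Aᵢ._≈_ i (x i) (y i)) → x ≈ y
  ≈-tuple x≈y = (proj₁ ∘ x≈y) , (proj₂ ∘ x≈y)

  0-component : ∀ i → Aᵢ._≈_ i (0q i) (Aᵢ.0q i)
  0-component i = Aᵢ.⋁-least i _ _ (λ ()) , Aᵢ.0-least i _

  ∨-component : ∀ x y i → Aᵢ._≈_ i ((x ∨ y) i) (Aᵢ._∨_ i (x i) (y i))
  ∨-component x y i =
      Aᵢ.⋁-least i _ _ (λ { true → Aᵢ.x≤x∨y i ; false → Aᵢ.y≤x∨y i })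
    , Aᵢ.∨-least i (Aᵢ.⋁-upper i _ true) (Aᵢ.⋁-upper i _ false)

  ∧-component : ∀ x y i → Aᵢ._≈_ i ((x ∧ y) i) (Aᵢ._∧_ i (x i) (y i))
  ∧-component x y i =
      Aᵢ.⋁-least i _ _ (λ (z , z≤x , z≤y) → Aᵢ.∧-greatest i (z≤x i) (z≤y i))
    , Aᵢ.⋁-least i _ _ (λ (w , w≤xᵢ , w≤yᵢ) → lift w w≤xᵢ w≤yᵢ)
    where
    lift : ∀ w → Aᵢ._≤_ i w (x i) → Aᵢ._≤_ i w (y i) → Aᵢ._≤_ i w ((x ∧ y) i)
    lift w w≤xᵢ w≤yᵢ =
      Aᵢ.≤-trans i (Aᵢ.≤-reflexive i (sym (update-same i w 0q)))
        (Aᵢ.⋁-upper i (λ z → proj₁ z i) (update i w 0q , below w≤xᵢ , below w≤yᵢ))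
      where
      below : ∀ {z} → Aᵢ._≤_ i w (z i) → update i w 0q ≤ z
      below {z} w≤zᵢ = update-pointwise (λ j v → Aᵢ._≤_ j v (z j)) w≤zᵢ
                         (λ {j} _ → 0-least z j)

  isComplemented-component : ∀ {e} → IsComplemented e → ∀ i → Aᵢ.IsComplemented i (e i)
  isComplemented-component {e} (b , e∨b≈1 , e∧b≈0) i =
      b i
    , Aᵢ.≈-trans i (Aᵢ.≈-sym i (∨-component e b i)) (≈-component e∨b≈1 i)
    , Aᵢ.≈-trans i (Aᵢ.≈-sym i (∧-component e b i))
        (Aᵢ.≈-trans i (≈-component e∧b≈0 i) (0-component i))

  isComplemented-tuple : ∀ {e} → (∀ i → Aᵢ.IsComplemented i (e i)) → IsComplemented e
  isComplemented-tuple {e} eᵢ-compl =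
      b
    , ≈-tuple (λ i → Aᵢ.≈-trans i (∨-component e b i) (proj₁ (proj₂ (eᵢ-compl i))))
    , ≈-tuple (λ i → Aᵢ.≈-trans i (∧-component e b i)
                       (Aᵢ.≈-trans i (proj₂ (proj₂ (eᵢ-compl i))) (Aᵢ.≈-sym i (0-component i))))
    where
    b : Carrier
    b = proj₁ ∘ eᵢ-compl

  isComplementedAbove-component : ∀ {a x} → IsComplementedAbove a x →
                                  ∀ i → Aᵢ.IsComplementedAbove i (a i) (x i)
  isComplementedAbove-component {a} {x} (y , a≤y , x∨y≈1 , x∧y≈a) i =
      y i , a≤y i
    , Aᵢ.≈-trans i (Aᵢ.≈-sym i (∨-component x y i)) (≈-component x∨y≈1 i)
    , Aᵢ.≈-trans i (Aᵢ.≈-sym i (∧-component x y i)) (≈-component x∧y≈a i)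

  isComplementedAbove-tuple : ∀ {a x} → (∀ i → Aᵢ.IsComplementedAbove i (a i) (x i)) →
                              IsComplementedAbove a x
  isComplementedAbove-tuple {a} {x} xᵢ-compl =
      y , (proj₁ ∘ proj₂ ∘ xᵢ-compl)
    , ≈-tuple (λ i → Aᵢ.≈-trans i (∨-component x y i) (proj₁ (proj₂ (proj₂ (xᵢ-compl i)))))
    , ≈-tuple (λ i → Aᵢ.≈-trans i (∧-component x y i) (proj₂ (proj₂ (proj₂ (xᵢ-compl i)))))
    where
    y : Carrier
    y = proj₁ ∘ xᵢ-compl

  hasLPAt-tuple : ∀ {a} → (∀ i → Aᵢ.HasLPAt i (a i)) → HasLPAt a
  hasLPAt-tuple {a} LPᵢ x a≤x x-compl =
      e
    , isComplemented-tuple (proj₁ ∘ proj₂ ∘ lift)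
    , ≈-tuple (λ i → Aᵢ.≈-trans i (∨-component e a i) (proj₂ (proj₂ (lift i))))
    where
    lift : ∀ i → Σ (C i) (λ e → Aᵢ.IsComplemented i e × Aᵢ._≈_ i (Aᵢ._∨_ i e (a i)) (x i))
    lift i = LPᵢ i (x i) (a≤x i) (isComplementedAbove-component x-compl i)
    e : Carrier
    e = proj₁ ∘ lift

  hasLPAt-component : ∀ {a} → HasLPAt a → ∀ i → Aᵢ.HasLPAt i (a i)
  hasLPAt-component {a} LP i x aᵢ≤x x-compl =
      e i
    , isComplemented-component e-compl i
    , Aᵢ.≈-trans i (Aᵢ.≈-sym i (∨-component e a i))
        (subst (Aᵢ._≈_ i ((e ∨ a) i)) (update-same i x 1q) (≈-component e∨a≈x′ i))
    where
    x′ : Carrier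
    x′ = update i x 1q
    a≤x′ : a ≤ x′
    a≤x′ = update-pointwise (λ j v → Aᵢ._≤_ j (a j) v) aᵢ≤x (λ {j} _ → Aᵢ.1-top j _)
    x′-compl : IsComplementedAbove a x′
    x′-compl = isComplementedAbove-tuple
      (update-pointwise (λ j → Aᵢ.IsComplementedAbove j (a j)) x-compl
                        (λ {j} _ → Aᵢ.1-isComplementedAbove j (a j)))
    lifted : Σ Carrier (λ e → IsComplemented e × ((e ∨ a) ≈ x′))
    lifted = LP x′ a≤x′ x′-compl
    e : Carrier
    e = proj₁ lifted
    e-compl : IsComplemented e
    e-compl = proj₁ (proj₂ lifted)
    e∨a≈x′ : (e ∨ a) ≈ x′
    e∨a≈x′ = proj₂ (proj₂ lifted)

  isCompact-tuple : ∀ {c} → (∀ i → Aᵢ.IsCompact i (c i)) → IsCompact c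
  isCompact-tuple {c} cᵢ-compact {I} f c≤⋁f =
      _ , lookup chosen
    , λ i → Aᵢ.≤-trans i (proj₂ (proj₂ (finite i)))
              (Aᵢ.⋁-least i _ _ (λ l → Aᵢ.⋁-lookup-upper i (λ t → f t i)
                                         (∈-concatMap⁺ chosenAt (tabulate⁺ i (∈-tabulate⁺ l)))))
    where
    finite : ∀ i → Σ ℕ (λ k → Σ (Fin k → I) (λ g → Aᵢ._≤_ i (c i) (Aᵢ.⋁ i (λ l → f (g l) i))))
    finite i = cᵢ-compact i (λ t → f t i) (c≤⋁f i)
    chosenAt : Fin n → List I
    chosenAt i = tabulate (proj₁ (proj₂ (finite i)))
    chosen : List I
    chosen = concatMap chosenAt (allFin n)

  -- The hypothesis on the other coordinates replaces the case distinction on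
  -- whether I is empty, which is not available constructively.
  isCompact-component : ∀ {c} i → IsCompact c → (∀ {j} → i ≢ j → Aᵢ._≤_ j (c j) (Aᵢ.0q j)) →
                        Aᵢ.IsCompact i (c i)
  isCompact-component {c} i c-compact cⱼ≤0 {I} f cᵢ≤⋁f = restrict (c-compact F c≤⋁F)
    where
    F : I → Carrier
    F t = update i (f t) 0q
    c≤⋁F : c ≤ ⋁ F
    c≤⋁F = onComponents i
      (Aᵢ.≤-trans i cᵢ≤⋁f (Aᵢ.⋁-mono i (λ t → Aᵢ.≤-reflexive i (sym (update-same i (f t) 0q)))))
      (λ {j} i≢j → Aᵢ.≤-trans j (cⱼ≤0 i≢j) (Aᵢ.0-least j _))
    restrict : Σ ℕ (λ k → Σ (Fin k → I) (λ g → c ≤ ⋁ (F ∘ g))) →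
               Σ ℕ (λ k → Σ (Fin k → I) (λ g → Aᵢ._≤_ i (c i) (Aᵢ.⋁ i (f ∘ g))))
    restrict (k , g , c≤⋁Fg) =
      k , g , Aᵢ.≤-trans i (c≤⋁Fg i)
                (Aᵢ.⋁-mono i (λ l → Aᵢ.≤-reflexive i (update-same i (f (g l)) 0q)))

  ≈1-byComponents : ∀ i {x} → Aᵢ._≤_ i (Aᵢ.1q i) (x i) →
                    (∀ {j} → i ≢ j → Aᵢ._≤_ j (Aᵢ.1q j) (x j)) → x ≈ 1q
  ≈1-byComponents i {x} 1≤xᵢ 1≤xⱼ =
    1-top x , onComponents i {R = λ j → Aᵢ._≤_ j (Aᵢ.1q j) (x j)} 1≤xᵢ 1≤xⱼ

  update-≈1 : ∀ {i v d} → update i v d ≈ 1q → Aᵢ._≈_ i v (Aᵢ.1q i)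
  update-≈1 {i} {v} {d} u≈1 =
    subst (λ w → Aᵢ._≈_ i w (Aᵢ.1q i)) (update-same i v d) (≈-component u≈1 i)

  isMax-absorb : ∀ {M} i {x} → IsMax M → Aᵢ._≤_ i (M i) x → ¬ (update i x M ≈ 1q) →
                 Aᵢ._≤_ i x (M i)
  isMax-absorb {M} i {x} (_ , M-max) Mᵢ≤x u≉1 =
    subst (λ v → Aᵢ._≤_ i v (M i)) (update-same i x M) (proj₁ (M-max (update i x M) M≤u u≉1) i)
    where
    M≤u : M ≤ update i x M
    M≤u = update-pointwise (λ j → Aᵢ._≤_ j (M j)) Mᵢ≤x (λ {j} _ → Aᵢ.≤-refl j)

  isMax-component : ∀ {M} i → IsMax M → ¬ (Aᵢ._≈_ i (M i) (Aᵢ.1q i)) → Aᵢ.IsMax i (M i)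
  isMax-component i M-max Mᵢ≉1 =
    Mᵢ≉1 , λ x Mᵢ≤x x≉1 → isMax-absorb i M-max Mᵢ≤x (x≉1 ∘ update-≈1) , Mᵢ≤x

  isMax-update : ∀ i {m} → Aᵢ.IsMax i m → IsMax (update i m 1q)
  isMax-update i {m} (m≉1 , m-max) = m≉1 ∘ update-≈1 , M-max
    where
    M : Carrier
    M = update i m 1q
    M-max : ∀ X → M ≤ X → ¬ (X ≈ 1q) → X ≈ M
    M-max X M≤X X≉1 = X≤M , M≤X
      where
      m≤Xᵢ : Aᵢ._≤_ i m (X i)
      m≤Xᵢ = subst (λ v → Aᵢ._≤_ i v (X i)) (update-same i m 1q) (M≤X i)
      Xᵢ≉1 : ¬ (Aᵢ._≈_ i (X i) (Aᵢ.1q i))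
      Xᵢ≉1 Xᵢ≈1 = X≉1 (≈1-byComponents i (proj₂ Xᵢ≈1) (λ {j} i≢j →
        subst (λ v → Aᵢ._≤_ j v (X j)) (update-other m 1q i≢j) (M≤X j)))
      X≤M : X ≤ M
      X≤M = update-pointwise (λ j → Aᵢ._≤_ j (X j)) (proj₁ (m-max (X i) m≤Xᵢ Xᵢ≉1))
                             (λ {j} _ → Aᵢ.1-top j (X j))

  ≤r-component : ∀ {c} → c ≤ r → ∀ i → Aᵢ._≤_ i (c i) (Aᵢ.r i)
  ≤r-component {c} c≤r i = Aᵢ.≤-r i (λ m m-max →
    Aᵢ.≤-trans i (c≤r i)
      (Aᵢ.≤-trans i (r≤max (isMax-update i m-max) i) (Aᵢ.≤-reflexive i (update-same i m 1q))))

  -- For M maximal, raising the i-th coordinate of M to M i ∨ c i cannot reach 1: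
  -- otherwise M i ≠ 1, so M i is maximal in Aᵢ and already contains c i ≤ r(Aᵢ).
  ≤r-tuple : ∀ {c} → (∀ i → Aᵢ._≤_ i (c i) (Aᵢ.r i)) → c ≤ r
  ≤r-tuple {c} cᵢ≤r = ≤-r λ M M-max i →
    Aᵢ.≤-trans i (Aᵢ.y≤x∨y i) (isMax-absorb i M-max (Aᵢ.x≤x∨y i) (raised≉1 M-max i))
    where
    raised≉1 : ∀ {M} → IsMax M → ∀ i → ¬ (update i (Aᵢ._∨_ i (M i) (c i)) M ≈ 1q)
    raised≉1 {M} M-max@(M≉1 , _) i u≈1 = Mᵢ≉1 (Aᵢ.1-top i (M i) , 1≤Mᵢ)
      where
      Mᵢ≉1 : ¬ (Aᵢ._≈_ i (M i) (Aᵢ.1q i))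
      Mᵢ≉1 Mᵢ≈1 = M≉1 (≈1-byComponents i (proj₂ Mᵢ≈1) (λ {j} i≢j →
        subst (Aᵢ._≤_ j (Aᵢ.1q j)) (update-other _ M i≢j) (proj₂ u≈1 j)))
      1≤Mᵢ : Aᵢ._≤_ i (Aᵢ.1q i) (M i)
      1≤Mᵢ = Aᵢ.≤-trans i (proj₂ (update-≈1 u≈1))
               (Aᵢ.∨-least i (Aᵢ.≤-refl i)
                 (Aᵢ.≤-trans i (cᵢ≤r i) (Aᵢ.r≤max i (isMax-component i M-max Mᵢ≉1))))

  hasStarAt-tuple : ∀ {a} → (∀ i → Aᵢ.HasStarAt i (a i)) → HasStarAt a
  hasStarAt-tuple {a} starᵢ =
      c
    , isCompact-tuple (λ i → let (_ , cᵢ-compact , _) = starᵢ i in cᵢ-compact)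
    , ≤r-tuple (λ i → let (_ , _ , cᵢ≤r , _) = starᵢ i in cᵢ≤r)
    , e
    , isComplemented-tuple (λ i → let (_ , _ , _ , _ , eᵢ-compl , _) = starᵢ i in eᵢ-compl)
    , ≈-tuple (λ i → let (_ , _ , _ , _ , _ , aᵢ≈cᵢ∨eᵢ) = starᵢ i in
                     Aᵢ.≈-trans i aᵢ≈cᵢ∨eᵢ (Aᵢ.≈-sym i (∨-component c e i)))
    where
    c e : Carrier
    c i = proj₁ (starᵢ i)
    e i = proj₁ (proj₂ (proj₂ (proj₂ (starᵢ i))))

  hasStarAt-component : ∀ {a} i → HasStarAt a → (∀ {j} → i ≢ j → Aᵢ._≤_ j (a j) (Aᵢ.0q j)) →
                        Aᵢ.HasStarAt i (a i)
  hasStarAt-component {a} i (c , c-compact , c≤r , e , e-compl , a≈c∨e) aⱼ≤0 =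
      c i
    , isCompact-component i c-compact
        (λ {j} i≢j → Aᵢ.≤-trans j (x≤x∨y j) (Aᵢ.≤-trans j (proj₂ a≈c∨e j) (aⱼ≤0 i≢j)))
    , ≤r-component c≤r i
    , e i
    , isComplemented-component e-compl i
    , Aᵢ.≈-trans i (≈-component a≈c∨e i) (∨-component c e i)

  hasLP-∏ : HasLP (∏ n A) ⇔ (∀ i → HasLP (A i))
  hasLP-∏ = mk⇔
    (λ LP i a → subst (Aᵢ.HasLPAt i) (update-same i a 1q) (hasLPAt-component (LP (update i a 1q)) i))
    (λ LPᵢ a → hasLPAt-tuple (λ i → LPᵢ i (a i)))

  hasStar-∏ : HasStar (∏ n A) ⇔ (∀ i → HasStar (A i))
  hasStar-∏ = mk⇔
    (λ star i a → subst (Aᵢ.HasStarAt i) (update-same i a 0q)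
                    (hasStarAt-component i (star (update i a 0q))
                      (λ {j} i≢j → Aᵢ.≤-reflexive j (update-other a 0q i≢j))))
    (λ starᵢ a → hasStarAt-tuple (λ i → starᵢ i (a i)))

proposition7p8 : (n : ℕ) (A : Fin n → Quantale) → (∀ i → IsCoherent (A i)) →
    (HasLP (∏ n A) ⇔ (∀ i → HasLP (A i)))
    × (HasStar (∏ n A) ⇔ (∀ i → HasStar (A i)))
proposition7p8 n A _ = Product.hasLP-∏ A , Product.hasStar-∏ A
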